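{- For each $n\in\mathbb N$ with $n>11$, there exists an $n$-ary Boolean function $f:\mathbb B^n\to\mathbb B$ such that, for each $X\in\mathcal{IS}_{br}$ that computes $f$, $|X|>\lfloor 2^n/n\rfloor$.
   Context: Let $\mathbb B=\{\mathsf T,\mathsf F\}$. There are Boolean registers named $\mathtt{in}{:}i$ ($i\ge1$), $\mathtt{aux}{:}i$ ($i\ge1$) and $\mathtt{out}$, processing methods $\mathtt{set{:}T}$ (content becomes $\mathsf T$, reply $\mathsf T$), $\mathtt{set{:}F}$ (content becomes $\mathsf F$, reply $\mathsf F$), $\mathtt{get}$ (no change, reply is the content). Basic instructions are $f.m$ ($f$ register name, $m$ method). Primitive instructions: for each basic instruction $a$, the plain instruction $a$, positive test $+a$, negative test $-a$; forward jumps $\#l$ ($l\in\mathbb N$); termination $!$. An instruction sequence is a finite non-empty sequence $X=u_1;\dots;u_k$ of primitive instructions, $|X|=k$. Execution starts at $u_1$: $a$ executes $a$ and proceeds with the next instruction; $+a$ executes $a$ and proceeds with the next instruction if the reply is $\mathsf T$, otherwise skips the next instruction and proceeds with the one after; $-a$ likewise with reply roles reversed; $\#l$ proceeds with the $l$-th next instruction ($\#0$ causes inaction); $!$ terminates; if there is no instruction to proceed with, inaction occurs. $\mathcal{IS}_{br}$ is the set of instruction sequences whose basic instructions are all of the forms $\mathtt{in}{:}i.\mathtt{get}$, $\mathtt{aux}{:}i.\mathtt{get}$, $\mathtt{aux}{:}i.\mathtt{set{:}}b$, $\mathtt{out}.\mathtt{set{:}}b$ ($b\in\mathbb B$). $X$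 computes $f:\mathbb B^n\to\mathbb B$ if for all $b_1,\dots,b_n$, executing $X$ with $\mathtt{in}{:}i$ initially $b_i$ ($i\le n$) and all auxiliary registers and $\mathtt{out}$ initially $\mathsf F$, execution never executes an instruction on $\mathtt{in}{:}i$ with $i>n$, ends by executing $!$, and leaves $f(b_1,\dots,b_n)$ in $\mathtt{out}$. -}

module Defs where

open import Data.Bool using (Bool; true; false; if_then_else_)
open import Data.Nat using (ℕ; zero; suc; _+_; _≤_; _<_; _≤ᵇ_; _≡ᵇ_; NonZero; >-nonZero; z<s; s≤s)
open import Data.Nat.Properties using (≤-trans; n≤1+n)
open import Data.List using (List; []; _∷_; drop)
open import Data.List.NonEmpty using (List⁺; toList)
open import Data.List.Relation.Unary.All using (All)
open import Data.Vec using (Vec; lookup)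
open import Data.Fin using (Fin; fromℕ<)
open import Relation.Binary.PropositionalEquality using (_≡_)
open import Data.Product using (_×_)
open import Data.Unit using (⊤)
open import Data.Empty using (⊥)
open import Relation.Nullary using (yes; no)
open import Data.Nat using (_<?_)

-- Boolean truth values: true = T, false = F.

-- Register names. in:i and aux:i are indexed by the natural number i itself;
-- the names actually allowed are restricted to i ≥ 1 by IS-br below.
data RegName : Set where
  inR  : ℕ → RegName
  auxR : ℕ → RegName
  outR : RegName

data Method : Set where
  setT setF get : Method

record BasicInstr : Set where
  constructor _∙_
  field
    reg    : RegName
    method : Method

data PrimInstr : Set where
  plain : BasicInstr → PrimInstr
  ptest : BasicInstr → PrimInstr
  ntest : BasicInstr → PrimInstr
  jump  : ℕ → PrimInstr
  halt  : PrimInstr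

InstrSeq : Set
InstrSeq = List⁺ PrimInstr

∣_∣ : InstrSeq → ℕ
∣ X ∣ = Data.List.NonEmpty.length X

data BrBasic : BasicInstr → Set where
  in-get   : ∀ {i} → 1 ≤ i → BrBasic (inR i ∙ get)
  aux-get  : ∀ {i} → 1 ≤ i → BrBasic (auxR i ∙ get)
  aux-setT : ∀ {i} → 1 ≤ i → BrBasic (auxR i ∙ setT)
  aux-setF : ∀ {i} → 1 ≤ i → BrBasic (auxR i ∙ setF)
  out-setT : BrBasic (outR ∙ setT)
  out-setF : BrBasic (outR ∙ setF)

data BrPrim : PrimInstr → Set where
  plain : ∀ {a} → BrBasic a → BrPrim (plain a)
  ptest : ∀ {a} → BrBasic a → BrPrim (ptest a)
  ntest : ∀ {a} → BrBasic a → BrPrim (ntest a)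
  jump  : ∀ {l} → BrPrim (jump l)
  halt  : BrPrim halt

IS-br : InstrSeq → Set
IS-br X = All BrPrim (toList X)

record State : Set where
  constructor st
  field
    inC  : ℕ → Bool
    auxC : ℕ → Bool
    outC : Bool

data Outcome : Set where
  terminated : State → Outcome
  inaction   : Outcome
  badInput   : Outcome           -- an instruction on in:i with i > n (or a nonexistent in:0) was executed

update : (ℕ → Bool) → ℕ → Bool → (ℕ → Bool)
update f i b j = if j ≡ᵇ i then b else f j

applyMethod : Method → Bool → Bool × Bool   -- new content , reply
applyMethod setT _ = true  Data.Product., true
applyMethod setF _ = false Data.Product., false
applyMethod get  c = c     Data.Product., c

open import Data.Maybe using (Maybe; just; nothing)

execBasic : ℕ → BasicInstr → State → Maybe (State × Bool)
execBasic n (inR i ∙ m) (st ic ac oc) with 1 ≤ᵇ i | i ≤ᵇ n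
... | true | true =
  let r = applyMethod m (ic i) in
  just (st (update ic i (Data.Product.proj₁ r)) ac oc Data.Product., Data.Product.proj₂ r)
... | _ | _ = nothing
execBasic n (auxR i ∙ m) (st ic ac oc) =
  let r = applyMethod m (ac i) in
  just (st ic (update ac i (Data.Product.proj₁ r)) oc Data.Product., Data.Product.proj₂ r)
execBasic n (outR ∙ m) (st ic ac oc) =
  let r = applyMethod m oc in
  just (st ic ac (Data.Product.proj₁ r) Data.Product., Data.Product.proj₂ r)

-- Run the instruction sequence whose current instruction is the head of the list
-- (the list is the remaining suffix of X).  All jumps are forward, so every step
-- other than #0 (which is inaction) strictly advances; fuel |X| suffices.
-- Running out of fuel is mapped to inaction (never reached with fuel ≥ length).
run : ℕ → ℕ → List PrimInstr → State → Outcome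
run n zero    _  s = inaction
run n (suc k) [] s = inaction
run n (suc k) (plain a ∷ rest) s with execBasic n a s
... | nothing = badInput
... | just (s' Data.Product., _) = run n k rest s'
run n (suc k) (ptest a ∷ rest) s with execBasic n a s
... | nothing = badInput
... | just (s' Data.Product., true)  = run n k rest s'
... | just (s' Data.Product., false) = run n k (drop 1 rest) s'
run n (suc k) (ntest a ∷ rest) s with execBasic n a s
... | nothing = badInput
... | just (s' Data.Product., false) = run n k rest s'
... | just (s' Data.Product., true)  = run n k (drop 1 rest) s'
run n (suc k) (jump zero ∷ rest) s = inaction
run n (suc k) (jump (suc l) ∷ rest) s = run n k (drop l rest) s
run n (suc k) (halt ∷ rest) s = terminated s

-- initial state: in:i holds b_i for 1 ≤ i ≤ n, all aux registers and out hold F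
-- (in:i for i > n is never read: any access yields badInput)
initState : (n : ℕ) → Vec Bool n → State
initState n bs = st inInit (λ _ → false) false
  where
  inInit : ℕ → Bool
  inInit zero = false
  inInit (suc i) with i <? n
  ... | yes p = lookup bs (fromℕ< p)
  ... | no _  = false

execute : (n : ℕ) → InstrSeq → Vec Bool n → Outcome
execute n X bs = run n (suc ∣ X ∣) (toList X) (initState n bs)

Computes : (n : ℕ) → InstrSeq → (Vec Bool n → Bool) → Set
Computes n X f = ∀ (bs : Vec Bool n) →
  Data.Product.Σ State (λ s → execute n X bs ≡ terminated s × State.outC s ≡ f bs)

nonZero>11 : ∀ {n} → 11 < n → NonZero n
nonZero>11 {suc n} _ = _

-- Shannon's counting argument. A run of X consults only in:1 .. in:n, the at most |X|
-- auxiliary registers named in X, and out, and a jump overshooting the end of X causes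
-- inaction however far it overshoots. So renaming in:i with i > n to the equally forbidden
-- in:0, the auxiliary registers to aux:0, aux:1, ... in order of first occurrence, and
-- capping jump lengths at |X| + 1 preserves the computed function. When |X| ≤ m the result
-- is a word of length at most m over a fixed alphabet of 9n + 10m + 21 instructions. For
-- m = ⌊2^n/n⌋ and n > 11 there are at most (11m)^m < 2^(2^n) such words, so some n-ary
-- Boolean function is computed by none of them.

module Submission where

open import Defs
open import Data.Bool using (Bool; true; false; if_then_else_)
open import Data.Nat using (ℕ; _<_; _^_)
open import Data.Nat.DivMod using (_/_)
open import Data.Vec using (Vec)
open import Data.Product using (Σ)

open import Data.Empty using (⊥-elim)
open import Data.List
  using (List; []; _∷_; _++_; length; map; drop; upTo; cartesianProductWith; concatMap)
open import Data.List.NonEmpty using (toList)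
open import Data.List.Membership.Propositional using (_∈_; _∉_)
open import Data.List.Membership.Propositional.Properties
  using (∈-map⁺; ∈-++⁺ˡ; ∈-++⁺ʳ; ∈-upTo⁺; ∈-cartesianProductWith⁺)
open import Data.List.Properties using (length-++; length-map; length-upTo; length-drop; drop-map; drop-[])
open import Data.List.Relation.Binary.Subset.Propositional using (_⊆_)
open import Data.List.Relation.Unary.All as All using (All; []; _∷_)
open import Data.List.Relation.Unary.All.Properties using (drop⁺; map⁺)
open import Data.List.Relation.Unary.Any using (here; there)
open import Data.Maybe using (Maybe; just; nothing)
open import Data.Nat
  using (zero; suc; _+_; _*_; _⊓_; _≤_; _≤ᵇ_; _≡ᵇ_; _≟_; _<?_; z≤n; s≤s; >-nonZero)
open import Data.Nat.DivMod using (m*n/n≡m; m/n*n≤m; /-monoˡ-≤)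
open import Data.Nat.Properties
open import Data.Nat.Tactic.RingSolver using (solve-∀)
open import Data.Product using (∃; _×_; _,_; proj₁; proj₂)
open import Data.Vec using ([]; _∷_) renaming (_++_ to _++ᵥ_; take to takeᵥ; drop to dropᵥ)
open import Data.Vec.Properties using (take++drop≡id)
open import Function using (_∘_; _$_)
open import Relation.Binary.PropositionalEquality
open import Relation.Nullary using (¬_; yes; no; proof)
open import Relation.Nullary.Reflects using (Reflects; ofʸ; ofⁿ)

^-distribʳ-* : ∀ a b k → (a * b) ^ k ≡ a ^ k * b ^ k
^-distribʳ-* a b zero    = refl
^-distribʳ-* a b (suc k) = begin
  a * b * (a * b) ^ k        ≡⟨ cong (a * b *_) (^-distribʳ-* a b k) ⟩
  a * b * (a ^ k * b ^ k)    ≡⟨ interchange a b (a ^ k) (b ^ k) ⟩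
  a * a ^ k * (b * b ^ k)    ∎
  where
  open ≡-Reasoning
  interchange : ∀ a b x y → a * b * (x * y) ≡ a * x * (b * y)
  interchange = solve-∀

n[9n+22]≤2^n : ∀ {n} → 12 ≤ n → n * (9 * n + 22) ≤ 2 ^ n
n[9n+22]≤2^n 12≤n with k , refl ← m≤n⇒∃[o]m+o≡n 12≤n = from12 k
  where
  growth : ∀ k → 2 * ((12 + k) * (9 * (12 + k) + 22))
               ≡ (13 + k) * (9 * (13 + k) + 22) + (1313 + 220 * k + 9 * k * k)
  growth = solve-∀
  from12 : ∀ k → (12 + k) * (9 * (12 + k) + 22) ≤ 2 ^ (12 + k)
  from12 zero    = ≤ᵇ⇒≤ 1560 4096 _
  from12 (suc k) = begin
    (13 + k) * (9 * (13 + k) + 22)                                ≤⟨ m≤m+n _ _ ⟩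
    (13 + k) * (9 * (13 + k) + 22) + (1313 + 220 * k + 9 * k * k) ≡⟨ growth k ⟨
    2 * ((12 + k) * (9 * (12 + k) + 22))                          ≤⟨ *-monoʳ-≤ 2 (from12 k) ⟩
    2 ^ (13 + k)                                                  ∎
    where open ≤-Reasoning

-- After multiplying by n ^ m: (11 m n) ^ m ≤ 11 ^ m 2 ^ (n m) ≤ 11 ^ m 2 ^ 2 ^ n, and 11 ^ m < n ^ m.
[11m]^m<2^2^n : ∀ {n m} → 11 < n → 0 < m → m * n ≤ 2 ^ n → (11 * m) ^ m < 2 ^ 2 ^ n
[11m]^m<2^2^n {n} {m} 11<n 0<m mn≤2^n = *-cancelʳ-< (n ^ m) _ _ $ begin-strict
  (11 * m) ^ m * n ^ m    ≡⟨ ^-distribʳ-* (11 * m) n m ⟨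
  (11 * m * n) ^ m        ≡⟨ cong (_^ m) (*-assoc 11 m n) ⟩
  (11 * (m * n)) ^ m      ≤⟨ ^-monoˡ-≤ m (*-monoʳ-≤ 11 mn≤2^n) ⟩
  (11 * 2 ^ n) ^ m        ≡⟨ ^-distribʳ-* 11 (2 ^ n) m ⟩
  11 ^ m * (2 ^ n) ^ m    ≡⟨ cong (11 ^ m *_) (^-*-assoc 2 n m) ⟩
  11 ^ m * 2 ^ (n * m)    ≤⟨ *-monoʳ-≤ (11 ^ m) (^-monoʳ-≤ 2 (subst (_≤ 2 ^ n) (*-comm m n) mn≤2^n)) ⟩
  11 ^ m * 2 ^ 2 ^ n      <⟨ *-monoˡ-< (2 ^ 2 ^ n) {{m^n≢0 2 (2 ^ n)}} (^-monoˡ-< m 11<n) ⟩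
  n ^ m * 2 ^ 2 ^ n       ≡⟨ *-comm (n ^ m) (2 ^ 2 ^ n) ⟩
  2 ^ 2 ^ n * n ^ m       ∎
  where
  open ≤-Reasoning
  instance _ = >-nonZero 0<m

9n+22≤2^n/n : ∀ {n} (11<n : 11 < n) → 9 * n + 22 ≤ _/_ (2 ^ n) n {{nonZero>11 11<n}}
9n+22≤2^n/n {n} 11<n = begin
  9 * n + 22              ≡⟨ m*n/n≡m (9 * n + 22) n ⟨
  (9 * n + 22) * n / n    ≤⟨ /-monoˡ-≤ n (subst (_≤ 2 ^ n) (*-comm n (9 * n + 22)) (n[9n+22]≤2^n 11<n)) ⟩
  2 ^ n / n               ∎
  where
  open ≤-Reasoning
  instance _ = nonZero>11 11<n

9n+10m+21<11m : ∀ {n m} → 9 * n + 22 ≤ m → 9 * n + 10 * m + 21 < 11 * m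
9n+10m+21<11m {n} {m} 9n+22≤m = begin-strict
  9 * n + 10 * m + 21     ≡⟨ shuffle n m ⟩
  10 * m + (9 * n + 21)   <⟨ +-monoʳ-< (10 * m) (subst (_≤ m) (+-suc (9 * n) 21) 9n+22≤m) ⟩
  10 * m + m              ≡⟨ collect m ⟩
  11 * m                  ∎
  where
  open ≤-Reasoning
  shuffle : ∀ n m → 9 * n + 10 * m + 21 ≡ 10 * m + (9 * n + 21)
  shuffle = solve-∀
  collect : ∀ m → 10 * m + m ≡ 11 * m
  collect = solve-∀

length-cartesianProductWith : ∀ {A B C : Set} (f : A → B → C) xs ys →
  length (cartesianProductWith f xs ys) ≡ length xs * length ys
length-cartesianProductWith f []       ys = refl
length-cartesianProductWith f (x ∷ xs) ys = begin
  length (map (f x) ys ++ cartesianProductWith f xs ys)          ≡⟨ length-++ (map (f x) ys) ⟩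
  length (map (f x) ys) + length (cartesianProductWith f xs ys)  ≡⟨ cong₂ _+_ (length-map (f x) ys)
                                                                       (length-cartesianProductWith f xs ys) ⟩
  length ys + length xs * length ys                              ∎
  where open ≡-Reasoning

drop-⊓ : ∀ {A : Set} l {k} (xs : List A) → length xs ≤ k → drop (l ⊓ k) xs ≡ drop l xs
drop-⊓ zero    xs       _            = refl
drop-⊓ (suc l) {k} []   _            = drop-[] (suc l ⊓ k)
drop-⊓ (suc l) (x ∷ xs) (s≤s |xs|≤k) = drop-⊓ l xs |xs|≤k

length-drop-≤ : ∀ {A : Set} l (xs : List A) → length (drop l xs) ≤ length xs
length-drop-≤ l xs = subst (_≤ length xs) (sym (length-drop l xs)) (m∸n≤m (length xs) l)

wordsUpTo : ∀ {A : Set} → List A → ℕ → List (List A)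
wordsUpTo cs zero    = [] ∷ []
wordsUpTo cs (suc j) = [] ∷ cartesianProductWith _∷_ cs (wordsUpTo cs j)

length-wordsUpTo : ∀ {A : Set} (cs : List A) j → length (wordsUpTo cs j) ≤ suc (length cs) ^ j
length-wordsUpTo cs zero    = ≤-refl
length-wordsUpTo cs (suc j) = begin
  suc (length (cartesianProductWith _∷_ cs (wordsUpTo cs j)))
    ≡⟨ cong suc (length-cartesianProductWith _∷_ cs _) ⟩
  suc (length cs * length (wordsUpTo cs j))
    ≤⟨ s≤s (*-monoʳ-≤ (length cs) (length-wordsUpTo cs j)) ⟩
  suc (length cs * suc (length cs) ^ j)
    ≤⟨ +-monoˡ-≤ _ (m^n>0 (suc (length cs)) j) ⟩
  suc (length cs) ^ j + length cs * suc (length cs) ^ j ∎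
  where open ≤-Reasoning

∈-wordsUpTo : ∀ {A : Set} {cs : List A} {w} j → All (_∈ cs) w → length w ≤ j → w ∈ wordsUpTo cs j
∈-wordsUpTo zero    []         _           = here refl
∈-wordsUpTo (suc j) []         _           = here refl
∈-wordsUpTo (suc j) (c∈ ∷ w∈) (s≤s |w|≤j) =
  there (∈-cartesianProductWith⁺ _∷_ c∈ (∈-wordsUpTo j w∈ |w|≤j))

≡ᵇ-reflects-≡ : ∀ m n → Reflects (m ≡ n) (m ≡ᵇ n)
≡ᵇ-reflects-≡ m n = proof (m ≟ n)

position : List ℕ → ℕ → ℕ
position []      i = 0
position (x ∷ D) i = if i ≡ᵇ x then 0 else suc (position D i)

nth : List ℕ → ℕ → ℕ
nth []      _       = 0
nth (x ∷ D) zero    = x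
nth (x ∷ D) (suc p) = nth D p

nth-position : ∀ {D i} → i ∈ D → nth D (position D i) ≡ i
nth-position {x ∷ D} {i} i∈ with i ≡ᵇ x | ≡ᵇ-reflects-≡ i x | i∈
... | true  | ofʸ refl | _          = refl
... | false | ofⁿ i≢x  | here i≡x   = ⊥-elim (i≢x i≡x)
... | false | ofⁿ _    | there i∈D  = nth-position i∈D

position-< : ∀ {D i} → i ∈ D → position D i < length D
position-< {x ∷ D} {i} i∈ with i ≡ᵇ x | ≡ᵇ-reflects-≡ i x | i∈
... | true  | _        | _          = s≤s z≤n
... | false | ofⁿ i≢x  | here i≡x   = ⊥-elim (i≢x i≡x)
... | false | ofⁿ _    | there i∈D  = s≤s (position-< i∈D)

position-injective : ∀ {D i j} → i ∈ D → j ∈ D → position D i ≡ position D j → i ≡ j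
position-injective {D} {i} {j} i∈ j∈ eq = begin
  i                      ≡⟨ nth-position i∈ ⟨
  nth D (position D i)   ≡⟨ cong (nth D) eq ⟩
  nth D (position D j)   ≡⟨ nth-position j∈ ⟩
  j                      ∎
  where open ≡-Reasoning

-- The trailing [] is there because 2 ^ suc n unfolds to 2 ^ n + (2 ^ n + 0).
truthTable : ∀ n → (Vec Bool n → Bool) → Vec Bool (2 ^ n)
truthTable zero    g = g [] ∷ []
truthTable (suc n) g = truthTable n (g ∘ (true ∷_)) ++ᵥ (truthTable n (g ∘ (false ∷_)) ++ᵥ [])

fromTruthTable : ∀ n → Vec Bool (2 ^ n) → Vec Bool n → Bool
fromTruthTable zero    (b ∷ []) []          = b
fromTruthTable (suc n) t        (true ∷ v)  = fromTruthTable n (takeᵥ (2 ^ n) t) v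
fromTruthTable (suc n) t        (false ∷ v) = fromTruthTable n (takeᵥ (2 ^ n) (dropᵥ (2 ^ n) t)) v

truthTable-cong : ∀ n {g h : Vec Bool n → Bool} → g ≗ h → truthTable n g ≡ truthTable n h
truthTable-cong zero    g≗h = cong (_∷ []) (g≗h [])
truthTable-cong (suc n) g≗h = cong₂ (λ l r → l ++ᵥ (r ++ᵥ []))
  (truthTable-cong n (g≗h ∘ (true ∷_))) (truthTable-cong n (g≗h ∘ (false ∷_)))

truthTable-fromTruthTable : ∀ n t → truthTable n (fromTruthTable n t) ≡ t
truthTable-fromTruthTable zero    (b ∷ []) = refl
truthTable-fromTruthTable (suc n) t = begin
  truthTable n (fromTruthTable n l) ++ᵥ (truthTable n (fromTruthTable n r) ++ᵥ [])
    ≡⟨ cong₂ (λ l r → l ++ᵥ (r ++ᵥ [])) (truthTable-fromTruthTable n l) (truthTable-fromTruthTable n r) ⟩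
  l ++ᵥ (r ++ᵥ [])                        ≡⟨ cong (λ e → l ++ᵥ (r ++ᵥ e)) (empty (dropᵥ (2 ^ n) rest)) ⟩
  l ++ᵥ (r ++ᵥ dropᵥ (2 ^ n) rest)        ≡⟨ cong (l ++ᵥ_) (take++drop≡id (2 ^ n) rest) ⟩
  l ++ᵥ rest                              ≡⟨ take++drop≡id (2 ^ n) t ⟩
  t                                       ∎
  where
  open ≡-Reasoning
  rest : Vec Bool (2 ^ n + 0)
  rest = dropᵥ (2 ^ n) t
  l r : Vec Bool (2 ^ n)
  l = takeᵥ (2 ^ n) t
  r = takeᵥ (2 ^ n) rest
  empty : (e : Vec Bool 0) → [] ≡ e
  empty [] = refl

splitOnHead : ∀ {N} → List (Vec Bool (suc N)) → List (Vec Bool N) × List (Vec Bool N)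
splitOnHead []               = [] , []
splitOnHead ((true ∷ v) ∷ vs)  = let ts , fs = splitOnHead vs in v ∷ ts , fs
splitOnHead ((false ∷ v) ∷ vs) = let ts , fs = splitOnHead vs in ts , v ∷ fs

length-splitOnHead : ∀ {N} (vs : List (Vec Bool (suc N))) →
  length (proj₁ (splitOnHead vs)) + length (proj₂ (splitOnHead vs)) ≡ length vs
length-splitOnHead []                = refl
length-splitOnHead ((true ∷ v) ∷ vs)  = cong suc (length-splitOnHead vs)
length-splitOnHead ((false ∷ v) ∷ vs) = trans (+-suc _ _) (cong suc (length-splitOnHead vs))

∈-splitOnHead : ∀ {N} b {v} (vs : List (Vec Bool (suc N))) → (b ∷ v) ∈ vs →
  v ∈ (if b then proj₁ (splitOnHead vs) else proj₂ (splitOnHead vs))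
∈-splitOnHead true  ((true ∷ _) ∷ vs)  (here refl) = here refl
∈-splitOnHead false ((false ∷ _) ∷ vs) (here refl) = here refl
∈-splitOnHead true  ((true ∷ _) ∷ vs)  (there p)   = there (∈-splitOnHead true vs p)
∈-splitOnHead true  ((false ∷ _) ∷ vs) (there p)   = ∈-splitOnHead true vs p
∈-splitOnHead false ((true ∷ _) ∷ vs)  (there p)   = ∈-splitOnHead false vs p
∈-splitOnHead false ((false ∷ _) ∷ vs) (there p)   = there (∈-splitOnHead false vs p)

-- Split by the first coordinate: one of the two parts is shorter than 2 ^ N.
missingVec : ∀ N (vs : List (Vec Bool N)) → length vs < 2 ^ N → ∃ (_∉ vs)
missingVec zero    []      _        = [] , λ ()
missingVec zero    (_ ∷ _) (s≤s ())
missingVec (suc N) vs      |vs|<2^[1+N] with length (proj₁ (splitOnHead vs)) <? 2 ^ N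
... | yes |ts|<2^N = let v , v∉ = missingVec N _ |ts|<2^N in true ∷ v , v∉ ∘ ∈-splitOnHead true vs
... | no  |ts|≮2^N = let v , v∉ = missingVec N _ |fs|<2^N in false ∷ v , v∉ ∘ ∈-splitOnHead false vs
  where
  |fs|<2^N : length (proj₂ (splitOnHead vs)) < 2 ^ N
  |fs|<2^N = +-cancelˡ-< (length (proj₁ (splitOnHead vs))) _ _ $ begin-strict
    length (proj₁ (splitOnHead vs)) + length (proj₂ (splitOnHead vs)) ≡⟨ length-splitOnHead vs ⟩
    length vs                                  <⟨ |vs|<2^[1+N] ⟩
    2 ^ N + (2 ^ N + 0)                        ≡⟨ cong (2 ^ N +_) (+-identityʳ (2 ^ N)) ⟩
    2 ^ N + 2 ^ N                              ≤⟨ +-monoˡ-≤ (2 ^ N) (≮⇒≥ |ts|≮2^N) ⟩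
    length (proj₁ (splitOnHead vs)) + 2 ^ N    ∎
    where open ≤-Reasoning

missingFunction : ∀ n (gs : List (Vec Bool n → Bool)) → length gs < 2 ^ 2 ^ n →
  ∃ λ f → ∀ {g} → g ∈ gs → ¬ (g ≗ f)
missingFunction n gs |gs|<2^2^n = fromTruthTable n t , g≢f
  where
  t∉ : ∃ (_∉ map (truthTable n) gs)
  t∉ = missingVec (2 ^ n) (map (truthTable n) gs)
         (subst (_< 2 ^ 2 ^ n) (sym (length-map (truthTable n) gs)) |gs|<2^2^n)
  t : Vec Bool (2 ^ n)
  t = proj₁ t∉
  g≢f : ∀ {g} → g ∈ gs → ¬ (g ≗ fromTruthTable n t)
  g≢f g∈gs g≗f = proj₂ t∉ $
    subst (_∈ map (truthTable n) gs) (trans (truthTable-cong n g≗f) (truthTable-fromTruthTable n t))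
      (∈-map⁺ (truthTable n) g∈gs)

auxOf : RegName → List ℕ
auxOf (inR _)  = []
auxOf (auxR i) = i ∷ []
auxOf outR     = []

auxRegs : PrimInstr → List ℕ
auxRegs (plain a) = auxOf (BasicInstr.reg a)
auxRegs (ptest a) = auxOf (BasicInstr.reg a)
auxRegs (ntest a) = auxOf (BasicInstr.reg a)
auxRegs (jump _)  = []
auxRegs halt      = []

length-auxOf : ∀ r → length (auxOf r) ≤ 1
length-auxOf (inR _)  = z≤n
length-auxOf (auxR _) = ≤-refl
length-auxOf outR     = z≤n

length-auxRegs : ∀ u → length (auxRegs u) ≤ 1
length-auxRegs (plain a) = length-auxOf (BasicInstr.reg a)
length-auxRegs (ptest a) = length-auxOf (BasicInstr.reg a)
length-auxRegs (ntest a) = length-auxOf (BasicInstr.reg a)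
length-auxRegs (jump _)  = z≤n
length-auxRegs halt      = z≤n

length-concatMap-auxRegs : ∀ xs → length (concatMap auxRegs xs) ≤ length xs
length-concatMap-auxRegs []       = z≤n
length-concatMap-auxRegs (u ∷ xs) = begin
  length (auxRegs u ++ concatMap auxRegs xs)
    ≡⟨ length-++ (auxRegs u) ⟩
  length (auxRegs u) + length (concatMap auxRegs xs)
    ≤⟨ +-mono-≤ (length-auxRegs u) (length-concatMap-auxRegs xs) ⟩
  suc (length xs) ∎
  where open ≤-Reasoning

auxRegs-⊆-concatMap : ∀ xs → All (λ u → auxRegs u ⊆ concatMap auxRegs xs) xs
auxRegs-⊆-concatMap []       = []
auxRegs-⊆-concatMap (u ∷ xs) =
  ∈-++⁺ˡ ∷ All.map (λ v⊆ {i} i∈ → ∈-++⁺ʳ (auxRegs u) (v⊆ i∈)) (auxRegs-⊆-concatMap xs)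

registers : ℕ → ℕ → List RegName
registers n m = map inR (upTo (suc n)) ++ map auxR (upTo m) ++ outR ∷ []

methods : List Method
methods = setT ∷ setF ∷ get ∷ []

basicInstrs : ℕ → ℕ → List BasicInstr
basicInstrs n m = cartesianProductWith _∙_ (registers n m) methods

kinds : List (BasicInstr → PrimInstr)
kinds = plain ∷ ptest ∷ ntest ∷ []

basicPrims : ℕ → ℕ → List PrimInstr
basicPrims n m = cartesianProductWith _$_ kinds (basicInstrs n m)

jumps : ℕ → List PrimInstr
jumps m = map jump (upTo (2 + m))

alphabet : ℕ → ℕ → List PrimInstr
alphabet n m = basicPrims n m ++ jumps m ++ halt ∷ []

length-registers : ∀ n m → length (registers n m) ≡ suc n + (m + 1)
length-registers n m = begin
  length (registers n m)
    ≡⟨ length-++ (map inR (upTo (suc n))) ⟩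
  length (map inR (upTo (suc n))) + length (map auxR (upTo m) ++ outR ∷ [])
    ≡⟨ cong₂ _+_ (length-map inR (upTo (suc n))) (length-++ (map auxR (upTo m))) ⟩
  length (upTo (suc n)) + (length (map auxR (upTo m)) + 1)
    ≡⟨ cong₂ (λ i a → i + (a + 1)) (length-upTo (suc n)) (trans (length-map auxR (upTo m)) (length-upTo m)) ⟩
  suc n + (m + 1) ∎
  where open ≡-Reasoning

length-alphabet : ∀ n m → length (alphabet n m) ≡ 9 * n + 10 * m + 21
length-alphabet n m = begin
  length (basicPrims n m ++ jumps m ++ halt ∷ [])
    ≡⟨ length-++ (basicPrims n m) ⟩
  length (basicPrims n m) + length (jumps m ++ halt ∷ [])
    ≡⟨ cong₂ _+_ (length-cartesianProductWith _$_ kinds (basicInstrs n m)) (length-++ (jumps m)) ⟩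
  3 * length (basicInstrs n m) + (length (jumps m) + 1)
    ≡⟨ cong₂ (λ b j → 3 * b + (j + 1)) (length-cartesianProductWith _∙_ (registers n m) methods)
                                       (trans (length-map jump (upTo (2 + m))) (length-upTo (2 + m))) ⟩
  3 * (length (registers n m) * 3) + (2 + m + 1)
    ≡⟨ cong (λ r → 3 * (r * 3) + (2 + m + 1)) (length-registers n m) ⟩
  3 * ((suc n + (m + 1)) * 3) + (2 + m + 1)
    ≡⟨ count n m ⟩
  9 * n + 10 * m + 21 ∎
  where
  open ≡-Reasoning
  count : ∀ n m → 3 * ((suc n + (m + 1)) * 3) + (2 + m + 1) ≡ 9 * n + 10 * m + 21
  count = solve-∀

length-wordsUpTo-alphabet : ∀ {n m} → 11 < n → 9 * n + 22 ≤ m → m * n ≤ 2 ^ n →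
  length (wordsUpTo (alphabet n m) m) < 2 ^ 2 ^ n
length-wordsUpTo-alphabet {n} {m} 11<n 9n+22≤m mn≤2^n = begin-strict
  length (wordsUpTo (alphabet n m) m)   ≤⟨ length-wordsUpTo (alphabet n m) m ⟩
  suc (length (alphabet n m)) ^ m       ≤⟨ ^-monoˡ-≤ m |alphabet|<11m ⟩
  (11 * m) ^ m                          <⟨ [11m]^m<2^2^n 11<n 0<m mn≤2^n ⟩
  2 ^ 2 ^ n                             ∎
  where
  open ≤-Reasoning
  0<m : 0 < m
  0<m = ≤-trans (s≤s z≤n) (≤-trans (m≤n+m 22 (9 * n)) 9n+22≤m)
  |alphabet|<11m : length (alphabet n m) < 11 * m
  |alphabet|<11m = subst (_< 11 * m) (sym (length-alphabet n m)) (9n+10m+21<11m {n} 9n+22≤m)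

output : Outcome → Bool
output (terminated s) = State.outC s
output _              = false

_⊑_ : Outcome → Outcome → Set
o ⊑ o′ = ∀ {s} → o ≡ terminated s → output o′ ≡ State.outC s

semantics : (n : ℕ) → List PrimInstr → Vec Bool n → Bool
semantics n xs bs = output (run n (suc (length xs)) xs (initState n bs))

module Normalise (n : ℕ) (D : List ℕ) (k : ℕ) where

  normIn : ℕ → ℕ
  normIn i = if i ≤ᵇ n then i else 0

  normReg : RegName → RegName
  normReg (inR i)  = inR (normIn i)
  normReg (auxR i) = auxR (position D i)
  normReg outR     = outR

  normBasic : BasicInstr → BasicInstr
  normBasic (r ∙ mt) = normReg r ∙ mt

  normPrim : PrimInstr → PrimInstr
  normPrim (plain a) = plain (normBasic a)
  normPrim (ptest a) = ptest (normBasic a)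
  normPrim (ntest a) = ntest (normBasic a)
  normPrim (jump l)  = jump (l ⊓ suc k)
  normPrim halt      = halt

  normIn≤n : ∀ i → normIn i ≤ n
  normIn≤n i with i ≤ᵇ n | ≤ᵇ-reflects-≤ i n
  ... | true  | ofʸ i≤n = i≤n
  ... | false | _       = z≤n

  module _ {m} (|D|≤m : length D ≤ m) (k≤m : k ≤ m) where

    normReg-∈ : ∀ r → auxOf r ⊆ D → normReg r ∈ registers n m
    normReg-∈ (inR i)  _   = ∈-++⁺ˡ (∈-map⁺ inR (∈-upTo⁺ (s≤s (normIn≤n i))))
    normReg-∈ (auxR i) i∈D = ∈-++⁺ʳ (map inR (upTo (suc n))) (∈-++⁺ˡ (∈-map⁺ auxR (∈-upTo⁺
                               (≤-trans (position-< (i∈D (here refl))) |D|≤m))))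
    normReg-∈ outR     _   = ∈-++⁺ʳ (map inR (upTo (suc n))) (∈-++⁺ʳ (map auxR (upTo m)) (here refl))

    method-∈ : ∀ mt → mt ∈ methods
    method-∈ setT = here refl
    method-∈ setF = there (here refl)
    method-∈ get  = there (there (here refl))

    normBasic-∈ : ∀ a → auxOf (BasicInstr.reg a) ⊆ D → normBasic a ∈ basicInstrs n m
    normBasic-∈ (r ∙ mt) sub = ∈-cartesianProductWith⁺ _∙_ (normReg-∈ r sub) (method-∈ mt)

    kind-∈ : ∀ κ a → κ ∈ kinds → auxOf (BasicInstr.reg a) ⊆ D → κ (normBasic a) ∈ alphabet n m
    kind-∈ κ a κ∈ sub = ∈-++⁺ˡ (∈-cartesianProductWith⁺ _$_ κ∈ (normBasic-∈ a sub))

    normPrim-∈ : ∀ u → auxRegs u ⊆ D → normPrim u ∈ alphabet n m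
    normPrim-∈ (plain a) = kind-∈ plain a (here refl)
    normPrim-∈ (ptest a) = kind-∈ ptest a (there (here refl))
    normPrim-∈ (ntest a) = kind-∈ ntest a (there (there (here refl)))
    normPrim-∈ (jump l)  _ = ∈-++⁺ʳ (basicPrims n m) (∈-++⁺ˡ (∈-map⁺ jump {xs = upTo (2 + m)} (∈-upTo⁺ l⊓[1+k]<2+m)))
      where
      l⊓[1+k]<2+m : l ⊓ suc k < 2 + m
      l⊓[1+k]<2+m = s≤s (≤-trans (m⊓n≤n l (suc k)) (s≤s k≤m))
    normPrim-∈ halt      _ = ∈-++⁺ʳ (basicPrims n m) (∈-++⁺ʳ (jumps m) (here refl))

  record Renamed (s s′ : State) : Set where
    field
      inC-≡  : State.inC s ≡ State.inC s′
      auxC-≡ : ∀ {i} → i ∈ D → State.auxC s i ≡ State.auxC s′ (position D i)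
      outC-≡ : State.outC s ≡ State.outC s′

  data RenamedReply : Maybe (State × Bool) → Maybe (State × Bool) → Set where
    nothing : RenamedReply nothing nothing
    just    : ∀ {t t′ b} → Renamed t t′ → RenamedReply (just (t , b)) (just (t′ , b))

  execBasic-normIn : ∀ i mt s → execBasic n (inR (normIn i) ∙ mt) s ≡ execBasic n (inR i ∙ mt) s
  execBasic-normIn i mt (st ic ac oc) with i ≤ᵇ n in i≤ᵇn
  ... | true  rewrite i≤ᵇn = refl
  ... | false with 1 ≤ᵇ i
  ...   | true  = refl
  ...   | false = refl

  execBasic-inR : ∀ i mt {s s′} → Renamed s s′ →
    RenamedReply (execBasic n (inR i ∙ mt) s) (execBasic n (inR i ∙ mt) s′)
  execBasic-inR i mt {st ic ac oc} {st .ic ac′ oc′} record { inC-≡ = refl ; auxC-≡ = aux ; outC-≡ = out }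
    with 1 ≤ᵇ i | i ≤ᵇ n
  ... | true  | true  = just record { inC-≡ = refl ; auxC-≡ = aux ; outC-≡ = out }
  ... | true  | false = nothing
  ... | false | _     = nothing

  update-position : ∀ {f f′ : ℕ → Bool} {i j} b → i ∈ D → j ∈ D → f j ≡ f′ (position D j) →
    update f i b j ≡ update f′ (position D i) b (position D j)
  update-position {i = i} {j} b i∈D j∈D fj≡
    with j ≡ᵇ i | ≡ᵇ-reflects-≡ j i | position D j ≡ᵇ position D i | ≡ᵇ-reflects-≡ (position D j) (position D i)
  ... | true  | ofʸ refl | true  | _      = refl
  ... | true  | ofʸ refl | false | ofⁿ ne = ⊥-elim (ne refl)
  ... | false | ofⁿ ne   | true  | ofʸ eq = ⊥-elim (ne (position-injective j∈D i∈D eq))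
  ... | false | _        | false | _      = fj≡

  execBasic-normBasic : ∀ a {s s′} → auxOf (BasicInstr.reg a) ⊆ D → Renamed s s′ →
    RenamedReply (execBasic n a s) (execBasic n (normBasic a) s′)
  execBasic-normBasic (inR i ∙ mt) {s′ = s′} _ ≈ rewrite execBasic-normIn i mt s′ = execBasic-inR i mt ≈
  execBasic-normBasic (auxR i ∙ mt) {st ic ac oc} {st ic′ ac′ oc′} ⊆D ≈
    rewrite Renamed.auxC-≡ ≈ (⊆D (here refl)) =
    just record { inC-≡ = Renamed.inC-≡ ≈
                ; auxC-≡ = λ j∈D → update-position {ac} {ac′} _ (⊆D (here refl)) j∈D (Renamed.auxC-≡ ≈ j∈D)
                ; outC-≡ = Renamed.outC-≡ ≈ }
  execBasic-normBasic (outR ∙ mt) {st ic ac oc} {st ic′ ac′ oc′} _ ≈ with Renamed.outC-≡ ≈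
  ... | refl = just record { inC-≡ = Renamed.inC-≡ ≈ ; auxC-≡ = Renamed.auxC-≡ ≈ ; outC-≡ = refl }

  Fits : List PrimInstr → Set
  Fits xs = length xs ≤ k × All (λ u → auxRegs u ⊆ D) xs

  Fits-head : ∀ {u xs} → Fits (u ∷ xs) → auxRegs u ⊆ D
  Fits-head (_ , ⊆D ∷ _) = ⊆D

  Fits-length-tail : ∀ {u xs} → Fits (u ∷ xs) → length xs ≤ k
  Fits-length-tail {xs = xs} (|u∷xs|≤k , _) = ≤-trans (n≤1+n (length xs)) |u∷xs|≤k

  Fits-drop : ∀ l {u xs} → Fits (u ∷ xs) → Fits (drop l xs)
  Fits-drop l {xs = xs} fits@(_ , _ ∷ ⊆D) = ≤-trans (length-drop-≤ l xs) (Fits-length-tail fits) , drop⁺ l ⊆D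

  run-normPrim : ∀ fuel xs {s s′} → Fits xs → Renamed s s′ →
    run n fuel xs s ⊑ run n fuel (map normPrim xs) s′
  run-normPrim-drop : ∀ fuel l {u} xs {s s′} → Fits (u ∷ xs) → Renamed s s′ →
    run n fuel (drop l xs) s ⊑ run n fuel (drop l (map normPrim xs)) s′

  run-normPrim zero    _  _ _ = λ ()
  run-normPrim (suc _) [] _ _ = λ ()
  run-normPrim (suc fuel) (plain a ∷ xs) {s} {s′} fits ≈
    with execBasic n a s | execBasic n (normBasic a) s′ | execBasic-normBasic a (Fits-head fits) ≈
  ... | _ | _ | nothing = λ ()
  ... | _ | _ | just ≈′ = run-normPrim-drop fuel 0 xs fits ≈′
  run-normPrim (suc fuel) (ptest a ∷ xs) {s} {s′} fits ≈
    with execBasic n a s | execBasic n (normBasic a) s′ | execBasic-normBasic a (Fits-head fits) ≈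
  ... | _ | _ | nothing               = λ ()
  ... | _ | _ | just {b = true}  ≈′ = run-normPrim-drop fuel 0 xs fits ≈′
  ... | _ | _ | just {b = false} ≈′ = run-normPrim-drop fuel 1 xs fits ≈′
  run-normPrim (suc fuel) (ntest a ∷ xs) {s} {s′} fits ≈
    with execBasic n a s | execBasic n (normBasic a) s′ | execBasic-normBasic a (Fits-head fits) ≈
  ... | _ | _ | nothing               = λ ()
  ... | _ | _ | just {b = false} ≈′ = run-normPrim-drop fuel 0 xs fits ≈′
  ... | _ | _ | just {b = true}  ≈′ = run-normPrim-drop fuel 1 xs fits ≈′
  run-normPrim (suc fuel) (jump zero ∷ xs)    _    _ = λ ()
  run-normPrim (suc fuel) (jump (suc l) ∷ xs) fits ≈
    rewrite drop-⊓ l (map normPrim xs) (≤-trans (≤-reflexive (length-map normPrim xs)) (Fits-length-tail fits)) =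
    run-normPrim-drop fuel l xs fits ≈
  run-normPrim (suc fuel) (halt ∷ xs) _ ≈ = λ { refl → sym (Renamed.outC-≡ ≈) }

  run-normPrim-drop fuel l xs fits ≈ rewrite drop-map {f = normPrim} l xs =
    run-normPrim fuel (drop l xs) (Fits-drop l fits) ≈

  Renamed-initState : ∀ bs → Renamed (initState n bs) (initState n bs)
  Renamed-initState bs = record { inC-≡ = refl ; auxC-≡ = λ _ → refl ; outC-≡ = refl }

normalForm : ∀ n m X f → Computes n X f → ∣ X ∣ ≤ m →
  ∃ λ ys → ys ∈ wordsUpTo (alphabet n m) m × semantics n ys ≗ f
normalForm n m X f computes |X|≤m = map normPrim xs , normal∈ , normal≗f
  where
  xs : List PrimInstr
  xs = toList X
  D : List ℕ
  D  = concatMap auxRegs xs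
  open Normalise n D (length xs)
  fits : Fits xs
  fits = ≤-refl , auxRegs-⊆-concatMap xs
  normal∈ : map normPrim xs ∈ wordsUpTo (alphabet n m) m
  normal∈ = ∈-wordsUpTo m
    (map⁺ (All.map (normPrim-∈ (≤-trans (length-concatMap-auxRegs xs) |X|≤m) |X|≤m _) (proj₂ fits)))
    (subst (_≤ m) (sym (length-map normPrim xs)) |X|≤m)
  normal≗f : semantics n (map normPrim xs) ≗ f
  normal≗f bs = let s , terminates , out≡f = computes bs in begin
    output (run n (suc (length (map normPrim xs))) (map normPrim xs) (initState n bs))
      ≡⟨ cong (λ l → output (run n (suc l) (map normPrim xs) (initState n bs))) (length-map normPrim xs) ⟩
    output (run n (suc (length xs)) (map normPrim xs) (initState n bs))
      ≡⟨ run-normPrim (suc (length xs)) xs fits (Renamed-initState bs) terminates ⟩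
    State.outC s
      ≡⟨ out≡f ⟩
    f bs ∎
    where open ≡-Reasoning

theorem3 : (n : ℕ) → (h : 11 < n) →
    Σ (Vec Bool n → Bool) λ f →
      (X : InstrSeq) → IS-br X → Computes n X f →
        _/_ (2 ^ n) n {{nonZero>11 h}} < ∣ X ∣
theorem3 n 11<n = f , λ X _ computes → ≰⇒> λ |X|≤m →
  let ys , ys∈ , ys≗f = normalForm n m X f computes |X|≤m in f-unlisted (∈-map⁺ (semantics n) ys∈) ys≗f
  where
  instance _ = nonZero>11 11<n
  m : ℕ
  m = 2 ^ n / n
  programs : List (List PrimInstr)
  programs = wordsUpTo (alphabet n m) m
  unlisted : ∃ λ f → ∀ {g} → g ∈ map (semantics n) programs → ¬ (g ≗ f)
  unlisted = missingFunction n (map (semantics n) programs)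
    (subst (_< 2 ^ 2 ^ n) (sym (length-map (semantics n) programs))
      (length-wordsUpTo-alphabet 11<n (9n+22≤2^n/n 11<n) (m/n*n≤m (2 ^ n) n)))
  f : Vec Bool n → Bool
  f = proj₁ unlisted
  f-unlisted : ∀ {g} → g ∈ map (semantics n) programs → ¬ (g ≗ f)
  f-unlisted = proj₂ unlisted
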